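{- Let $M$ be a well-founded model of $\mathrm{ZF}^-$, and suppose $\langle M,\in\rangle$ is interpreted in itself via an isomorphism $i:\langle M,\in\rangle\to\langle \overline{M},\overline{\in}\rangle/{\simeq}$, where $\overline M$, $\overline\in$ and $\simeq$ are definable (possibly with parameters) in $M$. Then the interpretation isomorphism $i$ is unique, and furthermore $i$ is definable in $M$.
   Context: $\mathrm{ZF}^-$ denotes Zermelo–Fraenkel set theory without the power set axiom (formulated with the collection scheme, not merely replacement). A structure $N$ is interpreted in a structure $M$ if for some finite $k$ there is an $M$-definable (with parameters) class $N^*\subseteq M^k$, $M$-definable relations (and functions and constants, via their graphs) on $N^*$ interpreting the symbols of the language of $N$, and an $M$-definable equivalence relation $\simeq$ on $N^*$ that is a congruence for these relations, together with an isomorphism from $N$ onto the quotient structure $N^*/{\simeq}$. Since models of set theory have definable pairing, one may take $\overline M\subseteq M$ directly. -}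

module Defs where

open import Level using (0ℓ)
open import Data.Nat using (ℕ; zero; suc; _+_)
open import Data.Fin using (Fin)
import Data.Fin as Fin
open import Data.Product using (Σ; Σ-syntax; _×_; _,_)
open import Data.Sum using (_⊎_)
open import Data.Empty using (⊥)
open import Relation.Nullary using (¬_)
open import Relation.Binary.PropositionalEquality using (_≡_)
open import Function.Bundles using (_⇔_)
open import Induction.WellFounded using (WellFounded)
open import Data.Vec.Functional using (Vector; _∷_; _++_; head; tail)

record ∈-Structure : Set₁ where
  field
    Carrier : Set
    _∈_     : Carrier → Carrier → Set

data Formula : ℕ → Set where
  _∈'_ : ∀ {n} → Fin n → Fin n → Formula n
  _≐_  : ∀ {n} → Fin n → Fin n → Formula n
  ⊥'   : ∀ {n} → Formula n
  _∧'_ : ∀ {n} → Formula n → Formula n → Formula n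
  _∨'_ : ∀ {n} → Formula n → Formula n → Formula n
  _⇒'_ : ∀ {n} → Formula n → Formula n → Formula n
  ∀'   : ∀ {n} → Formula (suc n) → Formula n
  ∃'   : ∀ {n} → Formula (suc n) → Formula n

-- Tarskian satisfaction (variable 0 is the innermost bound variable).
Sat : (M : ∈-Structure) {n : ℕ} → Formula n →
      Vector (∈-Structure.Carrier M) n → Set
Sat M (x ∈' y) ρ = ∈-Structure._∈_ M (ρ x) (ρ y)
Sat M (x ≐ y)  ρ = ρ x ≡ ρ y
Sat M ⊥'       ρ = ⊥
Sat M (φ ∧' ψ) ρ = Sat M φ ρ × Sat M ψ ρ
Sat M (φ ∨' ψ) ρ = Sat M φ ρ ⊎ Sat M ψ ρ
Sat M (φ ⇒' ψ) ρ = Sat M φ ρ → Sat M ψ ρ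
Sat M (∀' φ)   ρ = (a : ∈-Structure.Carrier M) → Sat M φ (a ∷ ρ)
Sat M (∃' φ)   ρ = Σ[ a ∈ ∈-Structure.Carrier M ] Sat M φ (a ∷ ρ)

-- M ⊨ ZF⁻ (ZF without power set, with the collection scheme).
-- Each axiom/scheme is stated as the meaning of its universal closure;
-- in schemes, the parameters are the environment ρ.

module _ (M : ∈-Structure) where
  open ∈-Structure M

  Extensionality : Set
  Extensionality = ∀ x y → (∀ z → (z ∈ x) ⇔ (z ∈ y)) → x ≡ y

  Foundation : Set
  Foundation = ∀ x → Σ[ y ∈ Carrier ] y ∈ x →
               Σ[ y ∈ Carrier ] (y ∈ x × (∀ z → z ∈ y → ¬ (z ∈ x)))

  Pairing : Set
  Pairing = ∀ a b → Σ[ c ∈ Carrier ] (a ∈ c × b ∈ c)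

  Union : Set
  Union = ∀ a → Σ[ u ∈ Carrier ] (∀ y → y ∈ a → ∀ z → z ∈ y → z ∈ u)

  Infinity : Set
  Infinity = Σ[ I ∈ Carrier ]
    ( (Σ[ e ∈ Carrier ] (e ∈ I × (∀ z → ¬ (z ∈ e))))
    × (∀ x → x ∈ I → Σ[ s ∈ Carrier ]
         (s ∈ I × (∀ z → (z ∈ s) ⇔ (z ∈ x ⊎ z ≡ x)))) )

  SeparationScheme : Set
  SeparationScheme = ∀ {n} (φ : Formula (suc n)) (ρ : Vector Carrier n) a →
    Σ[ b ∈ Carrier ] (∀ x → (x ∈ b) ⇔ (x ∈ a × Sat M φ (x ∷ ρ)))

  CollectionScheme : Set
  CollectionScheme = ∀ {n} (φ : Formula (suc (suc n))) (ρ : Vector Carrier n) a →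
    (∀ x → x ∈ a → Σ[ y ∈ Carrier ] Sat M φ (x ∷ y ∷ ρ)) →
    Σ[ b ∈ Carrier ] (∀ x → x ∈ a →
      Σ[ y ∈ Carrier ] (y ∈ b × Sat M φ (x ∷ y ∷ ρ)))

  record ModelOfZF⁻ : Set where
    field
      extensionality : Extensionality
      foundation     : Foundation
      pairing        : Pairing
      union          : Union
      infinity       : Infinity
      separation     : SeparationScheme
      collection     : CollectionScheme

  WellFoundedModel : Set
  WellFoundedModel = WellFounded _∈_

  DefinableBy : ∀ {k p} → Formula (k + p) → Vector Carrier p →
                (Vector Carrier k → Set) → Set
  DefinableBy {k} φ params X = ∀ (x : Vector Carrier k) → X x ⇔ Sat M φ (x ++ params)

  Definable : ∀ {k} → (Vector Carrier k → Set) → Set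
  Definable {k} X = Σ[ p ∈ ℕ ] Σ[ φ ∈ Formula (k + p) ]
                    Σ[ params ∈ Vector Carrier p ] DefinableBy φ params X

  -- Data of an interpretation of the language {∈} in M, of dimension k,
  -- with parameters: domain N* ⊆ M^k, a binary relation Ē and an
  -- equivalence ≃ on N*, all given by formulas with shared parameters.

  record InterpretationData (k : ℕ) : Set where
    field
      nParams : ℕ
      params  : Vector Carrier nParams
      domF    : Formula (k + nParams)
      memF    : Formula ((k + k) + nParams)
      eqF     : Formula ((k + k) + nParams)

    Dom : Vector Carrier k → Set
    Dom x = Sat M domF (x ++ params)

    _∈̄_ : Vector Carrier k → Vector Carrier k → Set
    x ∈̄ y = Sat M memF ((x ++ y) ++ params)

    _≃_ : Vector Carrier k → Vector Carrier k → Set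
    x ≃ y = Sat M eqF ((x ++ y) ++ params)

    record IsInterpretation : Set where
      field
        ≃-refl  : ∀ x → Dom x → x ≃ x
        ≃-sym   : ∀ x y → Dom x → Dom y → x ≃ y → y ≃ x
        ≃-trans : ∀ x y z → Dom x → Dom y → Dom z → x ≃ y → y ≃ z → x ≃ z
        ∈̄-cong  : ∀ x x' y y' → Dom x → Dom x' → Dom y → Dom y' →
                  x ≃ x' → y ≃ y' → x ∈̄ y → x' ∈̄ y'

    -- An isomorphism i : ⟨M, ∈⟩ → ⟨N*, ∈̄⟩/≃, represented by its graph
    -- I a ȳ  :⇔  ȳ ∈ i(a)   (i(a) is an ≃-class of N*).
    record IsIsomorphism (I : Carrier → Vector Carrier k → Set) : Set where
      field
        inDom     : ∀ a y → I a y → Dom y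
        nonempty  : ∀ a → Σ[ y ∈ Vector Carrier k ] I a y
        classIn   : ∀ a y y' → I a y → I a y' → y ≃ y'
        classSat  : ∀ a y y' → I a y → Dom y' → y ≃ y' → I a y'
        injective  : ∀ a b y → I a y → I b y → a ≡ b
        surjective : ∀ y → Dom y → Σ[ a ∈ Carrier ] I a y
        hom : ∀ a b y z → I a y → I b z → (a ∈ b) ⇔ (y ∈̄ z)

  Graph : ∀ {k} → (Carrier → Vector Carrier k → Set) → Vector Carrier (suc k) → Set
  Graph I v = I (head v) (tail v)

Tuple : ∈-Structure → ℕ → Set
Tuple M k = Vector (∈-Structure.Carrier M) k

module Submission where

-- Uniqueness: by ∈-induction on a, if ȳ ∈ i(a) and ȳ ∈ j(b) then
-- z ∈ a ⇔ i(z) ∈̄ [ȳ] ⇔ j(z) ∈̄ [ȳ] ⇔ z ∈ b, the middle step because i(z) = j(z) by induction;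
-- so a = b by extensionality.
--
-- Definability: i is determined by an ∈-recursion (the ∈̄-predecessors of i(a) are the classes
-- i(z), z ∈ a), and such a recursion is definable through set-sized approximations. Code k-tuples
-- by nested Kuratowski pairs and call a set f of pairs (b, c) an approximation if every such c
-- codes a point of N* whose ∈̄-predecessors are, up to ≃, exactly the f-values of the elements
-- of b, and f has a pair (z, e) for every element z of such a b. By ∈-induction on b, every pair
-- (b, c) of an approximation has c ∈ i(b). Conversely, by ∈-induction on a, collection gathers
-- approximations for the elements of a into a set B, and separation over ⋃B ∪ {(a, c)} with
-- c ∈ i(a) glues them into an approximation containing a. So ȳ ∈ i(a) iff ȳ ∈ N* and some
-- approximation pairs a with a code of a point ≃ ȳ, a first-order condition on a, ȳ and the
-- parameters.

open import Defs
open import Level using (0ℓ)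
open import Axiom.ExcludedMiddle using (ExcludedMiddle)
open import Data.Empty using (⊥)
open import Data.Nat using (ℕ; zero; suc; _+_)
open import Data.Fin using (Fin; zero; suc; #_; _↑ˡ_; _↑ʳ_; splitAt)
open import Data.Product using (Σ; _×_; _,_; proj₁; proj₂)
open import Data.Product.Function.NonDependent.Propositional using (_×-⇔_)
open import Data.Sum using (_⊎_; inj₁; inj₂; [_,_])
open import Data.Sum.Function.Propositional using (_⊎-⇔_)
open import Data.Sum.Properties using ([,]-∘; [,]-map)
open import Data.Vec.Functional using (Vector; []; _∷_; _++_; head; tail)
open import Data.Vec.Functional.Properties using (lookup-++ˡ; lookup-++ʳ; ++-cong)
open import Function using (_∘_; id)
open import Function.Bundles using (_⇔_; mk⇔; Equivalence)
open import Function.Construct.Identity using (⇔-id)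
open import Function.Construct.Symmetry using (⇔-sym)
open import Function.Construct.Composition using (_⇔-∘_)
open import Function.Related.TypeIsomorphisms using (→-cong-⇔)
open import Induction.WellFounded using (Acc; acc)
open import Relation.Binary.PropositionalEquality using (_≡_; _≗_; refl; sym; trans; subst)

open Equivalence using (to; from)

Π-cong-⇔ : {X : Set} {A B : X → Set} → (∀ x → A x ⇔ B x) → ((x : X) → A x) ⇔ ((x : X) → B x)
Π-cong-⇔ A⇔B = mk⇔ (λ f x → to (A⇔B x) (f x)) (λ g x → from (A⇔B x) (g x))

Σ-cong-⇔ : {X : Set} {A B : X → Set} → (∀ x → A x ⇔ B x) → Σ X A ⇔ Σ X B
Σ-cong-⇔ A⇔B = mk⇔ (λ (x , a) → x , to (A⇔B x) a) (λ (x , b) → x , from (A⇔B x) b)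

∘-++ : ∀ {A B : Set} {m n} (ρ : A → B) {xs : Vector A m} {ys : Vector A n} {u v} →
       ρ ∘ xs ≗ u → ρ ∘ ys ≗ v → ρ ∘ (xs ++ ys) ≗ u ++ v
∘-++ {m = m} ρ {xs} eu ev j = trans ([,]-∘ ρ (splitAt m j)) (++-cong (ρ ∘ xs) _ eu ev j)

liftRen : ∀ {n m} → (Fin n → Fin m) → Fin (suc n) → Fin (suc m)
liftRen σ zero    = zero
liftRen σ (suc j) = suc (σ j)

rename : ∀ {n m} → (Fin n → Fin m) → Formula n → Formula m
rename σ (x ∈' y) = σ x ∈' σ y
rename σ (x ≐ y)  = σ x ≐ σ y
rename σ ⊥'       = ⊥'
rename σ (φ ∧' ψ) = rename σ φ ∧' rename σ ψ
rename σ (φ ∨' ψ) = rename σ φ ∨' rename σ ψ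
rename σ (φ ⇒' ψ) = rename σ φ ⇒' rename σ ψ
rename σ (∀' φ)   = ∀' (rename (liftRen σ) φ)
rename σ (∃' φ)   = ∃' (rename (liftRen σ) φ)

∃ⁿ : ∀ k {n} → Formula (k + n) → Formula n
∃ⁿ zero    φ = φ
∃ⁿ (suc k) φ = ∃ⁿ k (∃' φ)

module Semantics (M : ∈-Structure) where
  open ∈-Structure M renaming (Carrier to C)

  liftRen-≗ : ∀ {n m} {σ : Fin n → Fin m} {ρ : Vector C m} {ρ′ : Vector C n} a →
              ρ ∘ σ ≗ ρ′ → (a ∷ ρ) ∘ liftRen σ ≗ a ∷ ρ′
  liftRen-≗ a e zero    = refl
  liftRen-≗ a e (suc j) = e j

  Sat-rename : ∀ {n m} (φ : Formula n) (σ : Fin n → Fin m) {ρ : Vector C m} {ρ′ : Vector C n} →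
               ρ ∘ σ ≗ ρ′ → Sat M (rename σ φ) ρ ⇔ Sat M φ ρ′
  Sat-rename (x ∈' y) σ e rewrite e x | e y = ⇔-id _
  Sat-rename (x ≐ y)  σ e rewrite e x | e y = ⇔-id _
  Sat-rename ⊥'       σ e = ⇔-id _
  Sat-rename (φ ∧' ψ) σ e = Sat-rename φ σ e ×-⇔ Sat-rename ψ σ e
  Sat-rename (φ ∨' ψ) σ e = Sat-rename φ σ e ⊎-⇔ Sat-rename ψ σ e
  Sat-rename (φ ⇒' ψ) σ e = →-cong-⇔ (Sat-rename φ σ e) (Sat-rename ψ σ e)
  Sat-rename (∀' φ)   σ e = Π-cong-⇔ λ a → Sat-rename φ (liftRen σ) (liftRen-≗ a e)
  Sat-rename (∃' φ)   σ e = Σ-cong-⇔ λ a → Sat-rename φ (liftRen σ) (liftRen-≗ a e)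

  Sat-cong : ∀ {n} (φ : Formula n) {ρ ρ′ : Vector C n} → ρ ≗ ρ′ → Sat M φ ρ ⇔ Sat M φ ρ′
  Sat-cong φ e = Sat-rename φ id e ⇔-∘ ⇔-sym (Sat-rename φ id λ _ → refl)

  ++-uncons : ∀ {k n} (v : Vector C (suc k)) (ρ : Vector C n) → v ++ ρ ≗ head v ∷ (tail v ++ ρ)
  ++-uncons v ρ zero        = refl
  ++-uncons {k} v ρ (suc j) = [,]-map (splitAt k j)

  Sat-∃ⁿ : ∀ k {n} (φ : Formula (k + n)) (ρ : Vector C n) →
           Sat M (∃ⁿ k φ) ρ ⇔ Σ (Vector C k) λ v → Sat M φ (v ++ ρ)
  Sat-∃ⁿ zero    φ ρ = mk⇔ (λ s → (λ ()) , s) proj₂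
  Sat-∃ⁿ (suc k) φ ρ = Σ-uncons ⇔-∘ Sat-∃ⁿ k (∃' φ) ρ
    where
      Σ-uncons : (Σ (Vector C k) λ v → Σ C λ a → Sat M φ (a ∷ (v ++ ρ))) ⇔
                 (Σ (Vector C (suc k)) λ v → Sat M φ (v ++ ρ))
      Σ-uncons = mk⇔ (λ (v , a , s) → a ∷ v , from (Sat-cong φ (++-uncons (a ∷ v) ρ)) s)
                     (λ (v , s) → tail v , head v , to (Sat-cong φ (++-uncons v ρ)) s)

-- Pairs and codes of tuples

module SetCoding (M : ∈-Structure) where
  open ∈-Structure M renaming (Carrier to C)

  IsPair : C → C → C → Set
  IsPair z x y = ∀ w → (w ∈ z → w ≡ x ⊎ w ≡ y) × (w ≡ x ⊎ w ≡ y → w ∈ z)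

  pairF : ∀ {n} → Fin n → Fin n → Fin n → Formula n
  pairF z x y = ∀' (((zero ∈' suc z) ⇒' ((zero ≐ suc x) ∨' (zero ≐ suc y))) ∧'
                    (((zero ≐ suc x) ∨' (zero ≐ suc y)) ⇒' (zero ∈' suc z)))

  -- Kuratowski pairs: p = {{x}, {x, y}}.
  OrdPairMember : C → C → C → Set
  OrdPairMember z x y = IsPair z x x ⊎ IsPair z x y

  IsOrdPair : C → C → C → Set
  IsOrdPair p x y = ∀ z → (z ∈ p → OrdPairMember z x y) × (OrdPairMember z x y → z ∈ p)

  ordPairF : ∀ {n} → Fin n → Fin n → Fin n → Formula n
  ordPairF p x y = ∀' (((zero ∈' suc p) ⇒' memberF) ∧' (memberF ⇒' (zero ∈' suc p)))
    where
      memberF : Formula (suc _)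
      memberF = pairF zero (suc x) (suc x) ∨' pairF zero (suc x) (suc y)

  -- (v₀, …, vₘ₋₁) is coded by (v₀, (v₁, … (vₘ₋₁, c₀))) for any c₀.
  Codes : ∀ m → C → Vector C m → Set
  Codes zero    c v = ⊥ → ⊥
  Codes (suc m) c v = Σ C λ d → Codes m d (tail v) × IsOrdPair c (head v) d

  codesF : ∀ m {n} → Fin n → (Fin m → Fin n) → Formula n
  codesF zero    c ys = ⊥' ⇒' ⊥'
  codesF (suc m) c ys = ∃' (codesF m zero (suc ∘ ys ∘ suc) ∧' ordPairF (suc c) (suc (ys zero)) zero)

  Sat-codesF : ∀ m {n} {ρ : Vector C n} c ys {c′ v} → ρ c ≡ c′ → ρ ∘ ys ≗ v →
               Sat M (codesF m c ys) ρ ⇔ Codes m c′ v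
  Sat-codesF zero    c ys refl e = ⇔-id _
  Sat-codesF (suc m) c ys refl e rewrite e zero =
    Σ-cong-⇔ λ d → Sat-codesF m zero (suc ∘ ys ∘ suc) refl (e ∘ suc) ×-⇔ ⇔-id _

module ZF⁻-Coding (M : ∈-Structure) (zf : ModelOfZF⁻ M) where
  open ∈-Structure M renaming (Carrier to C)
  open ModelOfZF⁻ zf
  open SetCoding M

  pair-exists : ∀ x y → Σ C λ z → IsPair z x y
  pair-exists x y with pairing x y
  ... | c , x∈c , y∈c with separation ((zero ≐ (# 1)) ∨' (zero ≐ (# 2))) (x ∷ y ∷ []) c
  ...   | z , z-spec = z , λ w → proj₂ ∘ to (z-spec w) , λ w≡ → from (z-spec w) (∈c w≡ , w≡)
    where
      ∈c : ∀ {w} → w ≡ x ⊎ w ≡ y → w ∈ c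
      ∈c (inj₁ refl) = x∈c
      ∈c (inj₂ refl) = y∈c

  pair-unique : ∀ {z z′ x y} → IsPair z x y → IsPair z′ x y → z ≡ z′
  pair-unique {z} {z′} z-pair z′-pair = extensionality z z′ λ w →
    mk⇔ (proj₂ (z′-pair w) ∘ proj₁ (z-pair w)) (proj₂ (z-pair w) ∘ proj₁ (z′-pair w))

  left-∈ : ∀ {z x y} → IsPair z x y → x ∈ z
  left-∈ {x = x} z-pair = proj₂ (z-pair x) (inj₁ refl)

  right-∈ : ∀ {z x y} → IsPair z x y → y ∈ z
  right-∈ {y = y} z-pair = proj₂ (z-pair y) (inj₂ refl)

  ∈-singleton : ∀ {z x w} → IsPair z x x → w ∈ z → w ≡ x
  ∈-singleton {w = w} z-pair w∈z = [ id , id ] (proj₁ (z-pair w) w∈z)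

  left-∈-ordPairMember : ∀ {z x y} → OrdPairMember z x y → x ∈ z
  left-∈-ordPairMember (inj₁ z-pair) = left-∈ z-pair
  left-∈-ordPairMember (inj₂ z-pair) = left-∈ z-pair

  ∈-ordPairMember : ∀ {z x y w} → OrdPairMember z x y → w ∈ z → w ≡ x ⊎ w ≡ y
  ∈-ordPairMember (inj₁ z-pair) w∈z = inj₁ (∈-singleton z-pair w∈z)
  ∈-ordPairMember {w = w} (inj₂ z-pair) w∈z = proj₁ (z-pair w) w∈z

  ordPair-exists : ∀ x y → Σ C λ p → IsOrdPair p x y
  ordPair-exists x y with pair-exists x x | pair-exists x y
  ... | sx , sx-pair | t , t-pair with pairing sx t
  ...   | c , sx∈c , t∈c
        with separation (pairF zero (# 1) (# 1) ∨' pairF zero (# 1) (# 2)) (x ∷ y ∷ []) c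
  ...     | p , p-spec = p , λ z → proj₂ ∘ to (p-spec z) , λ z-mem → from (p-spec z) (∈c z-mem , z-mem)
    where
      ∈c : ∀ {z} → OrdPairMember z x y → z ∈ c
      ∈c (inj₁ z-pair) rewrite pair-unique z-pair sx-pair = sx∈c
      ∈c (inj₂ z-pair) rewrite pair-unique z-pair t-pair  = t∈c

  ordPair-injectiveˡ : ∀ {p x y x′ y′} → IsOrdPair p x y → IsOrdPair p x′ y′ → x ≡ x′
  ordPair-injectiveˡ {x = x} op op′ with pair-exists x x
  ... | sx , sx-pair =
    sym (∈-singleton sx-pair (left-∈-ordPairMember (proj₁ (op′ sx) (proj₂ (op sx) (inj₁ sx-pair)))))

  -- y′ ∈ {x, y′} ∈ p forces y′ ∈ {x} or y′ ∈ {x, y}.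
  ordPair-second : ∀ {p x y y′} → IsOrdPair p x y → IsOrdPair p x y′ → y′ ≡ x ⊎ y′ ≡ y
  ordPair-second {x = x} {y′ = y′} op op′ with pair-exists x y′
  ... | t , t-pair = ∈-ordPairMember (proj₁ (op t) (proj₂ (op′ t) (inj₂ t-pair))) (right-∈ t-pair)

  ordPair-injectiveʳ : ∀ {p x y y′} → IsOrdPair p x y → IsOrdPair p x y′ → y ≡ y′
  ordPair-injectiveʳ op op′ with ordPair-second op op′ | ordPair-second op′ op
  ... | inj₂ y′≡y | _         = sym y′≡y
  ... | inj₁ _    | inj₂ y≡y′ = y≡y′
  ... | inj₁ y′≡x | inj₁ y≡x  = trans y≡x (sym y′≡x)

  ordPair-injective : ∀ {p x y x′ y′} → IsOrdPair p x y → IsOrdPair p x′ y′ →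
                      x ≡ x′ × y ≡ y′
  ordPair-injective op op′ with ordPair-injectiveˡ op op′
  ... | refl = refl , ordPair-injectiveʳ op op′

  covering-set : ∀ B x → Σ C λ S → (∀ u → u ∈ B → ∀ p → p ∈ u → p ∈ S) × x ∈ S
  covering-set B x with union B | pair-exists x x
  ... | ⋃B , ⋃B-spec | sx , sx-pair with pair-exists ⋃B sx
  ...   | t , t-pair with union t
  ...     | S , S-spec = S , (λ u u∈B p p∈u → S-spec ⋃B (left-∈ t-pair) p (⋃B-spec u u∈B p p∈u))
                           , S-spec sx (right-∈ t-pair) x (left-∈ sx-pair)

  -- Infinity is only used to see that M is nonempty, so that the empty tuple has a code.
  codes-exists : ∀ m (v : Vector C m) → Σ C λ c → Codes m c v
  codes-exists zero    v = proj₁ infinity , id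
  codes-exists (suc m) v with codes-exists m (tail v)
  ... | d , d-codes with ordPair-exists (head v) d
  ...   | c , c-pair = c , d , d-codes , c-pair

  codes-injective : ∀ m {c} {u v : Vector C m} → Codes m c u → Codes m c v → u ≗ v
  codes-injective (suc m) (d , d-codes , c-pair) (d′ , d′-codes , c-pair′) zero =
    proj₁ (ordPair-injective c-pair c-pair′)
  codes-injective (suc m) (d , d-codes , c-pair) (d′ , d′-codes , c-pair′) (suc j)
    with proj₂ (ordPair-injective c-pair c-pair′)
  ... | refl = codes-injective m d-codes d′-codes j

-- Uniqueness of the isomorphism

module _ (M : ∈-Structure) (extensionality : Extensionality M) (wf : WellFoundedModel M)
         {k : ℕ} (𝓘 : InterpretationData M k) where
  open ∈-Structure M renaming (Carrier to C)
  open InterpretationData 𝓘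

  isomorphism-⊆ : ∀ {I J : C → Vector C k → Set} → IsIsomorphism I → IsIsomorphism J →
                  ∀ a y → I a y → J a y
  isomorphism-⊆ {I} {J} isoI isoJ a = go a (wf a)
    where
      module I = IsIsomorphism isoI
      module J = IsIsomorphism isoJ
      go : ∀ a → Acc _∈_ a → ∀ y → I a y → J a y
      go a (acc rs) y Iay with J.surjective y (I.inDom a y Iay)
      ... | b , Jby = subst (λ x → J x y) (extensionality b a λ z → mk⇔ (b⊆a z) (a⊆b z)) Jby
        where
          a⊆b : ∀ z → z ∈ a → z ∈ b
          a⊆b z z∈a with I.nonempty z
          ... | w , Izw = from (J.hom z b w y (go z (rs z∈a) w Izw) Jby) (to (I.hom z a w y Izw Iay) z∈a)
          b⊆a : ∀ z → z ∈ b → z ∈ a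
          b⊆a z z∈b with J.nonempty z
          ... | w , Jzw with I.surjective w (J.inDom z w Jzw)
          ...   | x , Ixw = subst (_∈ a) (J.injective x z w (go x (rs x∈a) w Ixw) Jzw) x∈a
            where x∈a = from (I.hom x a w y Ixw Iay) (to (J.hom z b w y Jzw Jby) z∈b)

module CodedInterpretation (M : ∈-Structure) {k : ℕ} (𝓘 : InterpretationData M k) where
  open ∈-Structure M renaming (Carrier to C)
  open InterpretationData 𝓘
  open Semantics M
  open SetCoding M

  Rel : Formula ((k + k) + nParams) → Vector C k → Vector C k → Set
  Rel φ u v = Sat M φ ((u ++ v) ++ params)

  Dom-cong : ∀ {u v} → u ≗ v → Dom u → Dom v
  Dom-cong {u} {v} e = to (Sat-cong domF (++-cong u v e λ _ → refl))

  Rel-cong : ∀ φ {u u′ v v′} → u ≗ u′ → v ≗ v′ → Rel φ u v → Rel φ u′ v′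
  Rel-cong φ {u} {u′} {v} {v′} eu ev =
    to (Sat-cong φ (++-cong (u ++ v) (u′ ++ v′) (++-cong u u′ eu ev) λ _ → refl))

  domAt : ∀ {n} → (Fin k → Fin n) → (Fin nParams → Fin n) → Formula n
  domAt xs ps = rename (xs ++ ps) domF

  Sat-domAt : ∀ {n} {ρ : Vector C n} xs ps {v} → ρ ∘ xs ≗ v → ρ ∘ ps ≗ params →
              Sat M (domAt xs ps) ρ ⇔ Dom v
  Sat-domAt {ρ = ρ} xs ps ev ep = Sat-rename domF (xs ++ ps) (∘-++ ρ ev ep)

  relAt : ∀ {n} → Formula ((k + k) + nParams) →
          (Fin k → Fin n) → (Fin k → Fin n) → (Fin nParams → Fin n) → Formula n
  relAt φ xs ys ps = rename ((xs ++ ys) ++ ps) φ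

  Sat-relAt : ∀ {n} {ρ : Vector C n} φ xs ys ps {u v} →
              ρ ∘ xs ≗ u → ρ ∘ ys ≗ v → ρ ∘ ps ≗ params → Sat M (relAt φ xs ys ps) ρ ⇔ Rel φ u v
  Sat-relAt {ρ = ρ} φ xs ys ps eu ev ep = Sat-rename φ ((xs ++ ys) ++ ps) (∘-++ ρ (∘-++ ρ eu ev) ep)

  DomCode : C → Set
  DomCode c = Σ (Vector C k) λ v → Codes k c v × Dom v

  RelCode : Formula ((k + k) + nParams) → C → C → Set
  RelCode φ d c = Σ (Vector C k) λ u → Σ (Vector C k) λ v → Codes k d u × (Codes k c v × Rel φ u v)

  MemCode EqCode : C → C → Set
  MemCode = RelCode memF
  EqCode  = RelCode eqF

  domCodeF : ∀ {n} → Fin n → (Fin nParams → Fin n) → Formula n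
  domCodeF {n} c ps = ∃ⁿ k (codesF k (k ↑ʳ c) (_↑ˡ n) ∧' domAt (_↑ˡ n) ((k ↑ʳ_) ∘ ps))

  Sat-domCodeF : ∀ {n} (ρ : Vector C n) c ps → ρ ∘ ps ≗ params →
                 Sat M (domCodeF c ps) ρ ⇔ DomCode (ρ c)
  Sat-domCodeF ρ c ps ep = Σ-cong-⇔ (λ v →
      Sat-codesF k (k ↑ʳ c) _ (lookup-++ʳ v ρ c) (lookup-++ˡ v ρ)
    ×-⇔ Sat-domAt _ _ (lookup-++ˡ v ρ) (λ j → trans (lookup-++ʳ v ρ (ps j)) (ep j)))
    ⇔-∘ Sat-∃ⁿ k _ ρ

  relCodeF : ∀ {n} → Formula ((k + k) + nParams) → Fin n → Fin n → (Fin nParams → Fin n) → Formula n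
  relCodeF {n} φ d c ps = ∃ⁿ k (∃ⁿ k (
      codesF k (k ↑ʳ k ↑ʳ d) ((k ↑ʳ_) ∘ (_↑ˡ n)) ∧'
     (codesF k (k ↑ʳ k ↑ʳ c) (_↑ˡ (k + n)) ∧'
      relAt φ ((k ↑ʳ_) ∘ (_↑ˡ n)) (_↑ˡ (k + n)) ((k ↑ʳ_) ∘ (k ↑ʳ_) ∘ ps))))

  Sat-relCodeF : ∀ {n} (ρ : Vector C n) φ d c ps → ρ ∘ ps ≗ params →
                 Sat M (relCodeF φ d c ps) ρ ⇔ RelCode φ (ρ d) (ρ c)
  Sat-relCodeF ρ φ d c ps ep = Σ-cong-⇔ (λ u → Σ-cong-⇔ (λ v →
      Sat-codesF k _ _ (outer u v d) (first u v)
    ×-⇔ (Sat-codesF k _ _ (outer u v c) (lookup-++ˡ v (u ++ ρ))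
    ×-⇔ Sat-relAt φ _ _ _ (first u v) (lookup-++ˡ v (u ++ ρ)) (λ j → trans (outer u v (ps j)) (ep j))))
    ⇔-∘ Sat-∃ⁿ k _ (u ++ ρ))
    ⇔-∘ Sat-∃ⁿ k _ ρ
    where
      outer : ∀ u v j → (v ++ (u ++ ρ)) (k ↑ʳ k ↑ʳ j) ≡ ρ j
      outer u v j = trans (lookup-++ʳ v (u ++ ρ) (k ↑ʳ j)) (lookup-++ʳ u ρ j)
      first : ∀ u v → (v ++ (u ++ ρ)) ∘ (k ↑ʳ_) ∘ (_↑ˡ _) ≗ u
      first u v j = trans (lookup-++ʳ v (u ++ ρ) (j ↑ˡ _)) (lookup-++ˡ u ρ j)

  -- Sets f are read as relations: (b, c) ∈ f when some p ∈ f is the ordered pair (b, c).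
  MatchesMember : C → C → C → Set
  MatchesMember f b d =
    Σ C λ q → Σ C λ z → Σ C λ e → q ∈ f × (IsOrdPair q z e × (z ∈ b × EqCode d e))

  Respects : C → Set
  Respects f = ∀ p → p ∈ f → ∀ b c → IsOrdPair p b c →
    DomCode c ×
    (∀ d → DomCode d → (MemCode d c → MatchesMember f b d) × (MatchesMember f b d → MemCode d c))

  Closed : C → Set
  Closed f = ∀ p → p ∈ f → ∀ b c → IsOrdPair p b c → ∀ z → z ∈ b →
    Σ C λ q → Σ C λ e → q ∈ f × IsOrdPair q z e

  Approximation : C → Set
  Approximation f = Respects f × Closed f

  InDomain : C → C → Set
  InDomain a f = Σ C λ p → p ∈ f × Σ C λ e → IsOrdPair p a e

  matchesMemberF : ∀ {n} → Fin n → Fin n → Fin n → (Fin nParams → Fin n) → Formula n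
  matchesMemberF f b d ps = ∃' (∃' (∃' (((# 2) ∈' (3 ↑ʳ f)) ∧' (ordPairF (# 2) (# 1) (# 0) ∧'
    (((# 1) ∈' (3 ↑ʳ b)) ∧' relCodeF eqF (3 ↑ʳ d) (# 0) ((3 ↑ʳ_) ∘ ps))))))

  Sat-matchesMemberF : ∀ {n} (ρ : Vector C n) f b d ps → ρ ∘ ps ≗ params →
                       Sat M (matchesMemberF f b d ps) ρ ⇔ MatchesMember (ρ f) (ρ b) (ρ d)
  Sat-matchesMemberF ρ f b d ps ep = Σ-cong-⇔ λ q → Σ-cong-⇔ λ z → Σ-cong-⇔ λ e →
    ⇔-id _ ×-⇔ (⇔-id _ ×-⇔ (⇔-id _ ×-⇔ Sat-relCodeF _ eqF (3 ↑ʳ d) (# 0) _ ep))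

  respectsF : ∀ {n} → Fin n → (Fin nParams → Fin n) → Formula n
  respectsF f ps = ∀' (((# 0) ∈' suc f) ⇒' ∀' (∀' (ordPairF (# 2) (# 1) (# 0) ⇒'
    (domCodeF (# 0) ((3 ↑ʳ_) ∘ ps) ∧' ∀' (domCodeF (# 0) ((4 ↑ʳ_) ∘ ps) ⇒'
      ((memCodeF ⇒' matchesF) ∧' (matchesF ⇒' memCodeF)))))))
    where
      memCodeF matchesF : Formula (4 + _)
      memCodeF = relCodeF memF (# 0) (# 1) ((4 ↑ʳ_) ∘ ps)
      matchesF = matchesMemberF (4 ↑ʳ f) (# 2) (# 0) ((4 ↑ʳ_) ∘ ps)

  Sat-respectsF : ∀ {n} (ρ : Vector C n) f ps → ρ ∘ ps ≗ params →
                  Sat M (respectsF f ps) ρ ⇔ Respects (ρ f)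
  Sat-respectsF ρ f ps ep =
    Π-cong-⇔ λ p → →-cong-⇔ (⇔-id _) (Π-cong-⇔ λ b → Π-cong-⇔ λ c → →-cong-⇔ (⇔-id _)
      (Sat-domCodeF _ (# 0) _ ep ×-⇔ Π-cong-⇔ λ d → →-cong-⇔ (Sat-domCodeF _ (# 0) _ ep)
        (→-cong-⇔ memCode matches ×-⇔ →-cong-⇔ matches memCode)))
    where
      memCode : ∀ {p b c d} →
                Sat M (relCodeF memF (# 0) (# 1) ((4 ↑ʳ_) ∘ ps)) (d ∷ c ∷ b ∷ p ∷ ρ) ⇔ MemCode d c
      memCode = Sat-relCodeF _ memF (# 0) (# 1) _ ep
      matches : ∀ {p b c d} →
                Sat M (matchesMemberF (4 ↑ʳ f) (# 2) (# 0) ((4 ↑ʳ_) ∘ ps)) (d ∷ c ∷ b ∷ p ∷ ρ) ⇔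
                MatchesMember (ρ f) b d
      matches = Sat-matchesMemberF _ (4 ↑ʳ f) (# 2) (# 0) _ ep

  closedF : ∀ {n} → Fin n → Formula n
  closedF f = ∀' (((# 0) ∈' suc f) ⇒' ∀' (∀' (ordPairF (# 2) (# 1) (# 0) ⇒'
    ∀' (((# 0) ∈' (# 2)) ⇒' ∃' (∃' (((# 1) ∈' (6 ↑ʳ f)) ∧' ordPairF (# 1) (# 2) (# 0)))))))

  approximationF : ∀ {n} → Fin n → (Fin nParams → Fin n) → Formula n
  approximationF f ps = respectsF f ps ∧' closedF f

  Sat-approximationF : ∀ {n} (ρ : Vector C n) f ps → ρ ∘ ps ≗ params →
                       Sat M (approximationF f ps) ρ ⇔ Approximation (ρ f)
  Sat-approximationF ρ f ps ep = Sat-respectsF ρ f ps ep ×-⇔ ⇔-id _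

-- Definability of the isomorphism

module GraphDefinability (M : ∈-Structure) (zf : ModelOfZF⁻ M) (wf : WellFoundedModel M)
  {k : ℕ} (𝓘 : InterpretationData M k) (isI : InterpretationData.IsInterpretation 𝓘)
  (i : ∈-Structure.Carrier M → Vector (∈-Structure.Carrier M) k → Set)
  (iso : InterpretationData.IsIsomorphism 𝓘 i) where
  open ∈-Structure M renaming (Carrier to C)
  open InterpretationData 𝓘
  open IsInterpretation isI
  open IsIsomorphism iso
  open ModelOfZF⁻ zf
  open Semantics M
  open SetCoding M
  open ZF⁻-Coding M zf
  open CodedInterpretation M 𝓘

  i-cong : ∀ {a u v} → i a u → u ≗ v → i a v
  i-cong {a} {u} iau e = classSat a u _ iau (Dom-cong e du) (Rel-cong eqF (λ _ → refl) e (≃-refl u du))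
    where du = inDom a u iau

  RelCode-decode : ∀ φ {d c u v} → Codes k d u → Codes k c v → RelCode φ d c → Rel φ u v
  RelCode-decode φ d-codes c-codes (u′ , v′ , d-codes′ , c-codes′ , r) =
    Rel-cong φ (codes-injective k d-codes′ d-codes) (codes-injective k c-codes′ c-codes) r

  CodedImage : C → C → Set
  CodedImage b c = Σ (Vector C k) λ v → Codes k c v × i b v

  CodedImage-decode : ∀ {b c v} → Codes k c v → CodedImage b c → i b v
  CodedImage-decode c-codes (u , c-codes′ , ibu) = i-cong ibu (codes-injective k c-codes′ c-codes)

  Correct : C → Set
  Correct f = ∀ p → p ∈ f → ∀ b c → IsOrdPair p b c → CodedImage b c

  -- The code c lies in N*; the preimage a′ of its class has the same elements as b, because
  -- Respects pins down the ∈̄-predecessors of c and the hypothesis decodes them below b.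
  correct-step : ∀ {f p b c} → Approximation f → p ∈ f → IsOrdPair p b c →
                 (∀ z → z ∈ b → ∀ q e → q ∈ f → IsOrdPair q z e → CodedImage z e) →
                 CodedImage b c
  correct-step {f} {p} {b} {c} (respects , closed) p∈f bc IH =
    let (v , c-codes , dv) = proj₁ (respects p p∈f b c bc)
        (a′ , ia′v) = surjective v dv
        a′≡b = extensionality a′ b λ z → mk⇔ (a′⊆b c-codes ia′v z) (b⊆a′ c-codes ia′v z)
    in v , c-codes , subst (λ x → i x v) a′≡b ia′v
    where
      predecessors : ∀ d → DomCode d →
                     (MemCode d c → MatchesMember f b d) × (MatchesMember f b d → MemCode d c)
      predecessors = proj₂ (respects p p∈f b c bc)

      b⊆a′ : ∀ {v a′} → Codes k c v → i a′ v → ∀ z → z ∈ b → z ∈ a′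
      b⊆a′ {v} {a′} c-codes ia′v z z∈b =
        let (q , e , q∈f , ze) = closed p p∈f b c bc z z∈b
            (w , e-codes , izw) = IH z z∈b q e q∈f ze
            dw = inDom z w izw
            e∈̄c = proj₂ (predecessors e (w , e-codes , dw))
                     (q , z , e , q∈f , ze , z∈b , w , w , e-codes , e-codes , ≃-refl w dw)
        in from (hom z a′ w v izw ia′v) (RelCode-decode memF e-codes c-codes e∈̄c)

      a′⊆b : ∀ {v a′} → Codes k c v → i a′ v → ∀ z → z ∈ a′ → z ∈ b
      a′⊆b {v} {a′} c-codes ia′v z z∈a′ =
        let (w , izw) = nonempty z
            dw = inDom z w izw
            (d , d-codes) = codes-exists k w
            d∈̄c = w , v , d-codes , c-codes , to (hom z a′ w v izw ia′v) z∈a′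
            (q , z′ , e , q∈f , z′e , z′∈b , d≃e) = proj₁ (predecessors d (w , d-codes , dw)) d∈̄c
            (u , e-codes , iz′u) = IH z′ z′∈b q e q∈f z′e
            w≃u = RelCode-decode eqF d-codes e-codes d≃e
            iz′w = classSat z′ u w iz′u dw (≃-sym w u dw (inDom z′ u iz′u) w≃u)
        in subst (_∈ b) (injective z′ z w iz′w izw) z′∈b

  approximation-correct : ∀ {f} → Approximation f → Correct f
  approximation-correct {f} approx p p∈f b c bc = go b (wf b) p p∈f c bc
    where
      go : ∀ b → Acc _∈_ b → ∀ p → p ∈ f → ∀ c → IsOrdPair p b c → CodedImage b c
      go b (acc rs) p p∈f c bc =
        correct-step approx p∈f bc λ z z∈b q e q∈f ze → go z (rs z∈b) q q∈f e ze

  correct-respects : ∀ {f} → Correct f → Closed f → Respects f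
  correct-respects {f} correct closed p p∈f b c bc =
    let (v , c-codes , ibv) = correct p p∈f b c bc
        dv = inDom b v ibv
    in (v , c-codes , dv) ,
       λ d d-dom → mem→matches ibv c-codes d d-dom , matches→mem ibv c-codes dv d d-dom
    where
      mem→matches : ∀ {v} → i b v → Codes k c v →
                    ∀ d → DomCode d → MemCode d c → MatchesMember f b d
      mem→matches {v} ibv c-codes d (w , d-codes , dw) d∈̄c =
        let (z , izw) = surjective w dw
            z∈b = from (hom z b w v izw ibv) (RelCode-decode memF d-codes c-codes d∈̄c)
            (q , e , q∈f , ze) = closed p p∈f b c bc z z∈b
            (u , e-codes , izu) = correct q q∈f z e ze
        in q , z , e , q∈f , ze , z∈b , w , u , d-codes , e-codes , classIn z w u izw izu

      matches→mem : ∀ {v} → i b v → Codes k c v → Dom v →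
                    ∀ d → DomCode d → MatchesMember f b d → MemCode d c
      matches→mem {v} ibv c-codes dv d (w , d-codes , dw) (q , z , e , q∈f , ze , z∈b , d≃e) =
        let (u , e-codes , izu) = correct q q∈f z e ze
            du = inDom z u izu
            w≃u = RelCode-decode eqF d-codes e-codes d≃e
            u∈̄v = to (hom z b u v izu ibv) z∈b
        in w , v , d-codes , c-codes , ∈̄-cong u w v v du dw dv dv (≃-sym w u dw du w≃u) (≃-refl v dv) u∈̄v

  ApproximationAt : C → C → Set
  ApproximationAt z f = Approximation f × InDomain z f

  approximationAtF : Formula (2 + nParams)
  approximationAtF =
    approximationF (# 1) (2 ↑ʳ_) ∧' ∃' (((# 0) ∈' (# 2)) ∧' ∃' (ordPairF (# 1) (# 2) (# 0)))

  Sat-approximationAtF : ∀ z f → Sat M approximationAtF (z ∷ f ∷ params) ⇔ ApproximationAt z f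
  Sat-approximationAtF z f = Sat-approximationF _ (# 1) (2 ↑ʳ_) (λ _ → refl) ×-⇔ ⇔-id _

  -- The approximation for a: the pairs of the approximations collected in B, and pa = (a, ca).
  GluedMember : C → C → C → Set
  GluedMember B pa p = (Σ C λ u → u ∈ B × (Approximation u × p ∈ u)) ⊎ p ≡ pa

  gluedMemberF : Formula (3 + nParams)
  gluedMemberF =
    ∃' (((# 0) ∈' (# 2)) ∧' (approximationF (# 0) (4 ↑ʳ_) ∧' ((# 1) ∈' (# 0)))) ∨' ((# 0) ≐ (# 2))

  Sat-gluedMemberF : ∀ p B pa → Sat M gluedMemberF (p ∷ B ∷ pa ∷ params) ⇔ GluedMember B pa p
  Sat-gluedMemberF p B pa =
    Σ-cong-⇔ (λ u → ⇔-id _ ×-⇔ (Sat-approximationF _ (# 0) (4 ↑ʳ_) (λ _ → refl) ×-⇔ ⇔-id _))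
    ⊎-⇔ ⇔-id _

  approximation-glue : ∀ {a ca pa B f} → IsOrdPair pa a ca → CodedImage a ca →
    (∀ z → z ∈ a → Σ C λ u → u ∈ B × ApproximationAt z u) →
    (∀ p → p ∈ f ⇔ GluedMember B pa p) → ApproximationAt a f
  approximation-glue {a} {ca} {pa} {B} {f} a-ca a-image B-covers f-spec =
    (correct-respects correct closed , closed) , pa , from (f-spec pa) (inj₂ refl) , ca , a-ca
    where
      correct : Correct f
      correct p p∈f b c bc with to (f-spec p) p∈f
      ... | inj₁ (u , _ , u-approx , p∈u) = approximation-correct u-approx p p∈u b c bc
      ... | inj₂ refl with ordPair-injective a-ca bc
      ...   | refl , refl = a-image

      from-B : ∀ {u q} → u ∈ B → Approximation u → q ∈ u → q ∈ f
      from-B u∈B u-approx q∈u = from (f-spec _) (inj₁ (_ , u∈B , u-approx , q∈u))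

      closed : Closed f
      closed p p∈f b c bc z z∈b with to (f-spec p) p∈f
      ... | inj₁ (u , u∈B , u-approx , p∈u) =
        let (q , e , q∈u , ze) = proj₂ u-approx p p∈u b c bc z z∈b
        in q , e , from-B u∈B u-approx q∈u , ze
      ... | inj₂ refl with ordPair-injective a-ca bc
      ...   | refl , refl =
        let (u , u∈B , u-approx , q , q∈u , e , ze) = B-covers z z∈b
        in q , e , from-B u∈B u-approx q∈u , ze

  approximation-step : ∀ a → (∀ z → z ∈ a → Σ C (ApproximationAt z)) → Σ C (ApproximationAt a)
  approximation-step a IH = glue (collection approximationAtF params a λ z z∈a → encode (IH z z∈a))
    where
      encode : ∀ {z} → Σ C (ApproximationAt z) → Σ C λ f → Sat M approximationAtF (z ∷ f ∷ params)
      encode {z} (f , f-approx) = f , from (Sat-approximationAtF z f) f-approx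

      glue : (Σ C λ B → ∀ z → z ∈ a → Σ C λ u → u ∈ B × Sat M approximationAtF (z ∷ u ∷ params)) →
             Σ C (ApproximationAt a)
      glue (B , B-spec) =
        let (v , iav) = nonempty a
            (ca , ca-codes) = codes-exists k v
            (pa , a-ca) = ordPair-exists a ca
            (S , B⊆S , pa∈S) = covering-set B pa
            (f , f-sep) = separation gluedMemberF (B ∷ pa ∷ params) S
            ∈S : ∀ {p} → GluedMember B pa p → p ∈ S
            ∈S = λ { (inj₁ (u , u∈B , _ , p∈u)) → B⊆S u u∈B _ p∈u ; (inj₂ refl) → pa∈S }
            f-spec : ∀ p → p ∈ f ⇔ GluedMember B pa p
            f-spec p = mk⇔ (to (Sat-gluedMemberF p B pa) ∘ proj₂ ∘ to (f-sep p))
                           (λ m → from (f-sep p) (∈S m , from (Sat-gluedMemberF p B pa) m))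
        in f , approximation-glue a-ca (v , ca-codes , iav) B-covers f-spec
        where
          B-covers : ∀ z → z ∈ a → Σ C λ u → u ∈ B × ApproximationAt z u
          B-covers z z∈a =
            let (u , u∈B , s) = B-spec z z∈a in u , u∈B , to (Sat-approximationAtF z u) s

  approximation-exists : ∀ a → Σ C (ApproximationAt a)
  approximation-exists a = go a (wf a)
    where
      go : ∀ a → Acc _∈_ a → Σ C (ApproximationAt a)
      go a (acc rs) = approximation-step a λ z z∈a → go z (rs z∈a)

  GraphCondition : C → Vector C k → Set
  GraphCondition a y = Dom y × Σ C λ f → Approximation f ×
    Σ C λ p → p ∈ f × Σ C λ e → IsOrdPair p a e × Σ (Vector C k) λ u → Codes k e u × u ≃ y

  i⇔GraphCondition : ∀ a y → i a y ⇔ GraphCondition a y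
  i⇔GraphCondition a y = mk⇔ condition λ (dy , f , approx , p , p∈f , e , ae , u , e-codes , u≃y) →
    classSat a u y (CodedImage-decode e-codes (approximation-correct approx p p∈f a e ae)) dy u≃y
    where
      condition : i a y → GraphCondition a y
      condition iay =
        let (f , approx , p , p∈f , e , ae) = approximation-exists a
            (u , e-codes , iau) = approximation-correct approx p p∈f a e ae
        in inDom a y iay , f , approx , p , p∈f , e , ae , u , e-codes , classIn a u y iau iay

  graphF : Formula (suc k + nParams)
  graphF = domAt ys ps ∧' ∃' (approximationF (# 0) ((1 ↑ʳ_) ∘ ps) ∧' ∃' (((# 0) ∈' (# 1)) ∧'
             ∃' (ordPairF (# 1) (3 ↑ʳ a) (# 0) ∧'
               ∃ⁿ k (codesF k (k ↑ʳ (# 0)) (_↑ˡ _) ∧'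
                     relAt eqF (_↑ˡ _) ((k ↑ʳ_) ∘ (3 ↑ʳ_) ∘ ys) ((k ↑ʳ_) ∘ (3 ↑ʳ_) ∘ ps)))))
    where
      a : Fin (suc k + nParams)
      a = zero ↑ˡ nParams
      ys : Fin k → Fin (suc k + nParams)
      ys j = suc j ↑ˡ nParams
      ps : Fin nParams → Fin (suc k + nParams)
      ps = suc k ↑ʳ_

  Sat-graphF : ∀ (x : Vector C (suc k)) → Sat M graphF (x ++ params) ⇔ GraphCondition (head x) (tail x)
  Sat-graphF x =
    Sat-domAt _ _ (lookup-++ˡ x params ∘ suc) (lookup-++ʳ x params) ×-⇔
    Σ-cong-⇔ λ f → Sat-approximationF _ (# 0) _ (lookup-++ʳ x params) ×-⇔
    Σ-cong-⇔ λ p → ⇔-id _ ×-⇔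
    Σ-cong-⇔ λ e → ⇔-id _ ×-⇔ (Σ-cong-⇔ (λ u →
      Sat-codesF k _ _ (lookup-++ʳ u _ zero) (lookup-++ˡ u _) ×-⇔
      Sat-relAt eqF _ _ _ (lookup-++ˡ u _)
        (λ j → trans (lookup-++ʳ u _ _) (lookup-++ˡ x params (suc j)))
        (λ j → trans (lookup-++ʳ u _ _) (lookup-++ʳ x params j)))
    ⇔-∘ Sat-∃ⁿ k _ _)

mainTheorem2 : ExcludedMiddle 0ℓ →
    (M : ∈-Structure) → ModelOfZF⁻ M → WellFoundedModel M →
    {k : ℕ} (𝓘 : InterpretationData M k) →
    InterpretationData.IsInterpretation 𝓘 →
    (i : ∈-Structure.Carrier M → (Tuple M k) → Set) →
    InterpretationData.IsIsomorphism 𝓘 i →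
    ((j : ∈-Structure.Carrier M → (Tuple M k) → Set) →
       InterpretationData.IsIsomorphism 𝓘 j →
       ∀ a y → i a y ⇔ j a y)
    × Definable M (Graph M i)
mainTheorem2 _ M zf wf 𝓘 isI i iso =
    (λ j isoj a y → mk⇔ (isomorphism-⊆ M extensionality wf 𝓘 iso isoj a y)
                        (isomorphism-⊆ M extensionality wf 𝓘 isoj iso a y))
  , (nParams , graphF , params , λ x → ⇔-sym (Sat-graphF x) ⇔-∘ i⇔GraphCondition (head x) (tail x))
  where
    open ModelOfZF⁻ zf using (extensionality)
    open InterpretationData 𝓘 using (nParams; params)
    open GraphDefinability M zf wf 𝓘 isI i iso using (graphF; Sat-graphF; i⇔GraphCondition)
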